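{- Let $t$ be a positive integer and $\lambda\in\mathcal{DS}(t)$. If $h\in MD(\lambda)$, then $h\le 2t-1$.
   Context: Hook length of box $(i,j)$ of a Young diagram: number of boxes to its right in row $i$, plus number below it in column $j$, plus one. A partition is a $t$-core if no hook length is divisible by $t$; a $(t,t+1)$-core if it is both a $t$-core and a $(t+1)$-core. Self-conjugate: Young diagram symmetric about the main diagonal. $s(\lambda)$ (Durfee square size) is the largest $s$ such that $\lambda$ has at least $s$ parts $\ge s$. $MD(\lambda)$ is the set of hook lengths of the main-diagonal boxes $(i,i)$, $1\le i\le s(\lambda)$. $\mathcal{DS}(t)$ is the set of self-conjugate $(t,t+1)$-core partitions whose first $s(\lambda)$ parts are pairwise distinct, including the empty partition. -}

module Defs where

open import Data.Nat using (ℕ; zero; suc; _+_; _∸_; _≤_; _<_; _≥_; _≤?_)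
open import Data.Nat.Divisibility using (_∣_)
open import Data.List using (List; []; _∷_; length; filter)
open import Data.List.Relation.Unary.All using (All)
open import Data.List.Relation.Unary.Linked using (Linked)
open import Data.Product using (_×_; ∃)
open import Relation.Nullary using (¬_)
open import Relation.Binary.PropositionalEquality using (_≡_; _≢_)

IsPartition : List ℕ → Set
IsPartition λ′ = All (λ x → 1 ≤ x) λ′ × Linked _≥_ λ′

-- part λ i = λ_i (1-indexed); 0 when i = 0 or i exceeds the length.
part : List ℕ → ℕ → ℕ
part []       _             = 0
part (x ∷ xs) zero          = 0
part (x ∷ xs) (suc zero)    = x
part (x ∷ xs) (suc (suc i)) = part xs (suc i)

conj : List ℕ → ℕ → ℕ
conj λ′ j = length (filter (j ≤?_) λ′)

IsBox : List ℕ → ℕ → ℕ → Set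
IsBox λ′ i j = 1 ≤ i × 1 ≤ j × j ≤ part λ′ i

hook : List ℕ → ℕ → ℕ → ℕ
hook λ′ i j = (part λ′ i ∸ j) + (conj λ′ j ∸ i) + 1

IsCore : ℕ → List ℕ → Set
IsCore t λ′ = ∀ i j → IsBox λ′ i j → ¬ (t ∣ hook λ′ i j)

IsCore2 : ℕ → List ℕ → Set
IsCore2 t λ′ = IsCore t λ′ × IsCore (suc t) λ′

SelfConjugate : List ℕ → Set
SelfConjugate λ′ = ∀ j → 1 ≤ j → conj λ′ j ≡ part λ′ j

AtLeast : List ℕ → ℕ → Set
AtLeast λ′ s = s ≤ conj λ′ s

IsDurfee : List ℕ → ℕ → Set
IsDurfee λ′ s = AtLeast λ′ s × (∀ s′ → AtLeast λ′ s′ → s′ ≤ s)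

FirstDistinct : List ℕ → ℕ → Set
FirstDistinct λ′ s = ∀ i j → 1 ≤ i → i < j → j ≤ s → part λ′ i ≢ part λ′ j

InDS : ℕ → List ℕ → ℕ → Set
InDS t λ′ s = IsPartition λ′ × SelfConjugate λ′ × IsCore2 t λ′ × FirstDistinct λ′ s

InMD : List ℕ → ℕ → ℕ → Set
InMD λ′ s h = ∃ λ i → 1 ≤ i × i ≤ s × h ≡ hook λ′ i i

-- Both hook lengths t and t + 1 are forbidden, so walking along the first row the hook length
-- cannot decrease from ≥ t + 2 to < t without dropping by at least two at a single step.
-- If λ₁ > t, the first hook 2λ₁ − 1 is ≥ t + 2 and the hook past the end of the row is small,
-- so such a step j → j + 1 exists; there column j is at least two longer than column j + 1,
-- i.e. two consecutive rows both have length j. Self-conjugacy and distinctness of the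
-- parts inside the Durfee square rule this out, hence λ₁ ≤ t. A diagonal hook of a
-- self-conjugate partition is 2(λᵢ − i) + 1 ≤ 2(λ₁ − 1) + 1 ≤ 2t − 1.
module Submission where

open import Defs
open import Data.Nat using (ℕ; zero; suc; _+_; _*_; _∸_; _≤_; _<_; _≥_; _≤?_; z≤n; s≤s; s≤s⁻¹)
open import Data.Nat.Properties
open import Data.Nat.Divisibility using (∣-reflexive)
open import Data.Nat.Tactic.RingSolver using (solve-∀)
open import Data.List using (List; []; _∷_; length)
open import Data.List.Properties using (filter-accept; filter-reject)
open import Data.List.Relation.Unary.Linked as Linked using (Linked; _∷_)
open import Data.Product using (_,_; ∃-syntax; _×_; proj₁; proj₂)
open import Data.Empty using (⊥)
open import Function using (_∘_)
open import Relation.Nullary using (¬_; yes; no; contradiction)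
open import Relation.Unary using (Decidable)
open import Relation.Binary.PropositionalEquality
  using (_≡_; _≢_; refl; sym; trans; cong; cong₂; subst; module ≡-Reasoning)

∃-transition : ∀ {P : ℕ → Set} → Decidable P → ∀ n {j} → P j → ¬ P (n + j) →
               ∃[ k ] j ≤ k × P k × ¬ P (suc k)
∃-transition P? zero    Pj ¬Pj = contradiction Pj ¬Pj
∃-transition {P} P? (suc n) {j} Pj ¬Pn+j with P? (suc j)
... | no ¬P1+j = j , ≤-refl , Pj , ¬P1+j
... | yes P1+j with ∃-transition P? n P1+j (subst (¬_ ∘ P) (sym (+-suc n j)) ¬Pn+j)
...   | k , 1+j≤k , Pk , ¬P1+k = k , ≤-trans (n≤1+n j) 1+j≤k , Pk , ¬P1+k

conj-∷-accept : ∀ {x xs j} → j ≤ x → conj (x ∷ xs) j ≡ suc (conj xs j)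
conj-∷-accept j≤x = cong length (filter-accept (_ ≤?_) j≤x)

conj-∷-reject : ∀ {x xs j} → ¬ j ≤ x → conj (x ∷ xs) j ≡ conj xs j
conj-∷-reject j≰x = cong length (filter-reject (_ ≤?_) j≰x)

part≤head : ∀ {x xs} → Linked _≥_ (x ∷ xs) → ∀ i → part xs i ≤ x
part≤head {xs = []}     _            _             = z≤n
part≤head {xs = y ∷ ys} _            zero          = z≤n
part≤head {xs = y ∷ ys} (y≤x ∷ _)    (suc zero)    = y≤x
part≤head {xs = y ∷ ys} (y≤x ∷ y∷ys) (suc (suc i)) = ≤-trans (part≤head y∷ys (suc i)) y≤x

part≤part₁ : ∀ {λ′} → Linked _≥_ λ′ → ∀ i → part λ′ i ≤ part λ′ 1
part≤part₁ {[]}     _      _             = z≤n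
part≤part₁ {x ∷ xs} _      zero          = z≤n
part≤part₁ {x ∷ xs} _      (suc zero)    = ≤-refl
part≤part₁ {x ∷ xs} sorted (suc (suc i)) = part≤head sorted (suc i)

conj≡0 : ∀ {λ′ j} → Linked _≥_ λ′ → part λ′ 1 < j → conj λ′ j ≡ 0
conj≡0 {[]}     _      _   = refl
conj≡0 {x ∷ xs} sorted x<j = trans (conj-∷-reject (<⇒≱ x<j))
  (conj≡0 (Linked.tail sorted) (≤-<-trans (part≤head sorted 1) x<j))

≤-part⇒≤-conj : ∀ {λ′ i j} → Linked _≥_ λ′ → 1 ≤ j → j ≤ part λ′ i → i ≤ conj λ′ j
≤-part⇒≤-conj {[]}                     _ (s≤s _) ()
≤-part⇒≤-conj {x ∷ xs} {zero}          _ _       _   = z≤n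
≤-part⇒≤-conj {x ∷ xs} {suc zero}      _ _       j≤x rewrite conj-∷-accept {xs = xs} j≤x = s≤s z≤n
≤-part⇒≤-conj {x ∷ xs} {suc (suc i)} sorted 1≤j j≤λᵢ
  rewrite conj-∷-accept {xs = xs} (≤-trans j≤λᵢ (part≤head sorted (suc i))) =
  s≤s (≤-part⇒≤-conj (Linked.tail sorted) 1≤j j≤λᵢ)

≤-conj⇒≤-part : ∀ {λ′ i j} → Linked _≥_ λ′ → 1 ≤ i → i ≤ conj λ′ j → j ≤ part λ′ i
≤-conj⇒≤-part {[]} _ (s≤s _) ()
≤-conj⇒≤-part {x ∷ xs} {suc i} {j} sorted _ i≤λ′ⱼ with j ≤? x
... | no j≰x = contradiction (subst (suc i ≤_) (conj≡0 sorted (≰⇒> j≰x)) i≤λ′ⱼ) λ ()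
≤-conj⇒≤-part {x ∷ xs} {suc zero}    _      _ _     | yes j≤x = j≤x
≤-conj⇒≤-part {x ∷ xs} {suc (suc i)} sorted _ i≤λ′ⱼ | yes j≤x rewrite conj-∷-accept {xs = xs} j≤x =
  ≤-conj⇒≤-part (Linked.tail sorted) (s≤s z≤n) (s≤s⁻¹ i≤λ′ⱼ)

conj[1+j]<i≤conj[j]⇒part≡j : ∀ {λ′ i j} → Linked _≥_ λ′ →
  conj λ′ (suc j) < i → i ≤ conj λ′ j → part λ′ i ≡ j
conj[1+j]<i≤conj[j]⇒part≡j sorted λ′₁₊ⱼ<i i≤λ′ⱼ = ≤-antisym
  (≮⇒≥ λ j<λᵢ → <⇒≱ λ′₁₊ⱼ<i (≤-part⇒≤-conj sorted (s≤s z≤n) j<λᵢ))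
  (≤-conj⇒≤-part sorted (≤-trans (s≤s z≤n) λ′₁₊ⱼ<i) i≤λ′ⱼ)

diagonal-hook : ∀ {λ′ i} → SelfConjugate λ′ → 1 ≤ i →
  hook λ′ i i ≡ (part λ′ i ∸ i) + (part λ′ i ∸ i) + 1
diagonal-hook {λ′} {i} selfConj 1≤i = cong (λ c → (part λ′ i ∸ i) + (c ∸ i) + 1) (selfConj i 1≤i)

equal-rows⇒below-durfee : ∀ {λ′ s r} → SelfConjugate λ′ → (∀ s′ → AtLeast λ′ s′ → s′ ≤ s) →
  FirstDistinct λ′ s → 1 ≤ r → part λ′ r ≡ part λ′ (suc r) → part λ′ (suc r) ≤ r
equal-rows⇒below-durfee {λ′} {r = r} selfConj maximal distinct 1≤r λᵣ≡λᵣ₊₁ = ≮⇒≥ λ r<λᵣ₊₁ →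
  distinct r (suc r) 1≤r ≤-refl
    (maximal (suc r) (subst (suc r ≤_) (sym (selfConj (suc r) (s≤s z≤n))) r<λᵣ₊₁))
    λᵣ≡λᵣ₊₁

module FirstRow {t : ℕ} {λ′ : List ℕ} (sorted : Linked _≥_ λ′) (core : IsCore2 t λ′) where

  L : ℕ
  L = part λ′ 1

  c : ℕ → ℕ
  c = conj λ′

  hook₁ⱼ+j≡L+cⱼ : ∀ {j} → 1 ≤ j → j ≤ L → hook λ′ 1 j + j ≡ L + c j
  hook₁ⱼ+j≡L+cⱼ {j} 1≤j j≤L = begin
    (L ∸ j) + (c j ∸ 1) + 1 + j   ≡⟨ regroup (L ∸ j) (c j ∸ 1) j ⟩
    (L ∸ j + j) + (c j ∸ 1 + 1)   ≡⟨ cong₂ _+_ (m∸n+n≡m j≤L) (m∸n+n≡m (≤-part⇒≤-conj sorted 1≤j j≤L)) ⟩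
    L + c j                       ∎
    where
    open ≡-Reasoning
    regroup : ∀ a b j → a + b + 1 + j ≡ (a + j) + (b + 1)
    regroup = solve-∀

  core⇒L+cⱼ≢u+j : ∀ {u j} → IsCore u λ′ → 1 ≤ j → j ≤ L → L + c j ≢ u + j
  core⇒L+cⱼ≢u+j {u} {j} u-core 1≤j j≤L L+cⱼ≡u+j = u-core 1 j (s≤s z≤n , 1≤j , j≤L)
    (∣-reflexive (sym (+-cancelʳ-≡ j _ u (trans (hook₁ⱼ+j≡L+cⱼ 1≤j j≤L) L+cⱼ≡u+j))))

  -- hook(1, j + 1) is neither t nor t + 1, so if it is at most t + 1 it is below t.
  hook-gap : ∀ j → L + c (suc j) ≤ suc (suc (t + j)) → L + c (suc j) ≤ t + j
  hook-gap j small with suc j ≤? L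
  ... | no 1+j≰L rewrite conj≡0 sorted (≰⇒> 1+j≰L) | +-identityʳ L =
    ≤-trans (s≤s⁻¹ (≰⇒> 1+j≰L)) (m≤n+m j t)
  ... | yes 1+j≤L = s≤s⁻¹ (≤∧≢⇒< (s≤s⁻¹ (≤∧≢⇒< small ≢t+2)) ≢t+1)
    where
    ≢t+1 : L + c (suc j) ≢ suc (t + j)
    ≢t+1 e = core⇒L+cⱼ≢u+j (proj₁ core) (s≤s z≤n) 1+j≤L (trans e (sym (+-suc t j)))
    ≢t+2 : L + c (suc j) ≢ suc (suc (t + j))
    ≢t+2 e = core⇒L+cⱼ≢u+j (proj₂ core) (s≤s z≤n) 1+j≤L (trans e (cong suc (sym (+-suc t j))))

  -- For j ≤ L this says hook(1, j) ≥ t + 2.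
  BigHook : ℕ → Set
  BigHook j = suc (suc (t + j)) ≤ L + c j

  bigHook? : Decidable BigHook
  bigHook? j = suc (suc (t + j)) ≤? L + c j

  bigHook⇒≤L : ∀ {j} → BigHook j → j ≤ L
  bigHook⇒≤L {j} big = ≮⇒≥ λ L<j → <⇒≱
    (≤-trans L<j (≤-trans (m≤n+m j t) (≤-trans (n≤1+n _) (n≤1+n _))))
    (subst (suc (suc (t + j)) ≤_) (trans (cong (L +_) (conj≡0 sorted L<j)) (+-identityʳ L)) big)

  bigHook₁ : 1 ≤ t → t < L → SelfConjugate λ′ → BigHook 1
  bigHook₁ t≥1 t<L selfConj = subst (λ x → suc (suc (t + 1)) ≤ L + x) (sym (selfConj 1 (s≤s z≤n)))
    (subst (_≤ L + L) (cong suc (+-suc t 1)) (+-mono-≤ t<L (≤-trans (s≤s t≥1) t<L)))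

  transition⇒⊥ : ∀ {s j} → SelfConjugate λ′ → (∀ s′ → AtLeast λ′ s′ → s′ ≤ s) →
    FirstDistinct λ′ s → t < L → 1 ≤ j → BigHook j → ¬ BigHook (suc j) → ⊥
  transition⇒⊥ {j = j} selfConj maximal distinct t<L 1≤j big ¬big =
    1+n≰n (subst (suc r ≤_) (trans cⱼ≡j j≡r) column-drop)
    where
    c′ : ℕ
    c′ = c (suc j)

    r : ℕ
    r = suc c′

    gap : L + c′ ≤ t + j
    gap = hook-gap j (subst (L + c′ ≤_) (cong suc (+-suc t j)) (s≤s⁻¹ (≰⇒> ¬big)))

    r≤j : r ≤ j
    r≤j = +-cancelˡ-≤ t r j (≤-trans (≤-reflexive (+-suc t c′)) (≤-trans (+-monoˡ-≤ c′ t<L) gap))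

    column-drop : suc r ≤ c j
    column-drop = +-cancelˡ-≤ L (suc r) (c j)
      (≤-trans (≤-reflexive (trans (+-suc L r) (cong suc (+-suc L c′)))) (≤-trans (s≤s (s≤s gap)) big))

    rowᵣ≡j : part λ′ r ≡ j
    rowᵣ≡j = conj[1+j]<i≤conj[j]⇒part≡j sorted ≤-refl (≤-trans (n≤1+n r) column-drop)

    rowᵣ₊₁≡j : part λ′ (suc r) ≡ j
    rowᵣ₊₁≡j = conj[1+j]<i≤conj[j]⇒part≡j sorted (n≤1+n r) column-drop

    j≡r : j ≡ r
    j≡r = ≤-antisym (subst (_≤ r) rowᵣ₊₁≡j
      (equal-rows⇒below-durfee {λ′} selfConj maximal distinct (s≤s z≤n) (trans rowᵣ≡j (sym rowᵣ₊₁≡j)))) r≤j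

    cⱼ≡j : c j ≡ j
    cⱼ≡j = trans (selfConj j 1≤j) (trans (cong (part λ′) j≡r) rowᵣ≡j)

  part₁≤t : ∀ {s} → 1 ≤ t → SelfConjugate λ′ → (∀ s′ → AtLeast λ′ s′ → s′ ≤ s) →
    FirstDistinct λ′ s → L ≤ t
  part₁≤t t≥1 selfConj maximal distinct = ≮⇒≥ λ t<L →
    let (j , 1≤j , big , ¬big) = ∃-transition bigHook? L (bigHook₁ t≥1 t<L selfConj)
                                   (1+n≰n ∘ subst (_≤ L) (+-comm L 1) ∘ bigHook⇒≤L)
    in transition⇒⊥ selfConj maximal distinct t<L 1≤j big ¬big

lemma2p3 : (t : ℕ) → 1 ≤ t → (λ′ : List ℕ) → (s : ℕ) → IsDurfee λ′ s →
    InDS t λ′ s → (h : ℕ) → InMD λ′ s h → h ≤ 2 * t ∸ 1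
lemma2p3 t t≥1 λ′ s (_ , maximal) ((_ , sorted) , selfConj , core , distinct) h (i , 1≤i , _ , h≡hookᵢᵢ) =
  begin
  h                      ≡⟨ trans h≡hookᵢᵢ (diagonal-hook {λ′} selfConj 1≤i) ⟩
  a + a + 1              ≤⟨ +-monoˡ-≤ 1 (+-mono-≤ a≤t∸1 a≤t∸1) ⟩
  (t ∸ 1) + (t ∸ 1) + 1  ≡⟨ double-pred+1 t≥1 ⟩
  2 * t ∸ 1              ∎
  where
  open ≤-Reasoning
  a : ℕ
  a = part λ′ i ∸ i

  a≤t∸1 : a ≤ t ∸ 1
  a≤t∸1 = ∸-mono (≤-trans (part≤part₁ sorted i)
                          (FirstRow.part₁≤t sorted core t≥1 selfConj maximal distinct)) 1≤i

  double-pred+1 : ∀ {n} → 1 ≤ n → (n ∸ 1) + (n ∸ 1) + 1 ≡ 2 * n ∸ 1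
  double-pred+1 {suc n} _ = 2n+1≡2[1+n]∸1 n
    where
    2n+1≡2[1+n]∸1 : ∀ n → n + n + 1 ≡ n + suc (n + 0)
    2n+1≡2[1+n]∸1 = solve-∀
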